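{- Let $\Gamma$ be a finite simple graph and $k\ge0$ an integer. Then $-1$ is an eigenvalue of $A(\Gamma)$ of multiplicity $k$ (multiplicity $0$ meaning $-1$ is not an eigenvalue) if and only if $k=|V(\Gamma)|-\mathrm{rank}(I+A(S\Omega(\Gamma)))$.
   Context: $A(G)$ denotes the adjacency matrix of a graph $G$; rank is over the reals. For a graph $\Gamma$, consider partitions of $V(\Gamma)$ into nonempty parts such that each part induces a complete subgraph and, for any two distinct parts $P,Q$, either every vertex of $P$ is adjacent to every vertex of $Q$ or no vertex of $P$ is adjacent to any vertex of $Q$. The complete skeleton $\Omega(\Gamma)$ is such a partition with the minimum number of parts; its structure $S\Omega(\Gamma)$ is the simple graph whose vertices are the parts, two parts being adjacent iff they are completely joined.
   Formalization: Rank and the multiplicity of the eigenvalue −1 are taken over the rationals rather than the reals, with eigenvectors in ℚ^n. -}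

module Defs where

open import Data.Nat using (ℕ; zero; suc; _≤_)
open import Data.Fin using (Fin; zero; suc)
open import Data.Bool using (Bool; true; false; if_then_else_)
open import Data.Rational using (ℚ; 0ℚ; 1ℚ; _+_; _*_; -_)
open import Data.Product using (Σ; ∃; _×_)
open import Relation.Binary.PropositionalEquality using (_≡_; _≢_)
open import Relation.Nullary using (¬_)
open import Function using (_∘_; _⇔_)

record Graph (n : ℕ) : Set where
  field
    adj     : Fin n → Fin n → Bool
    adj-sym : ∀ u v → adj u v ≡ adj v u
    adj-irr : ∀ u → adj u u ≡ false
open Graph public

-- Real matrices are represented by rational matrices (all matrices here are 0/1).
Matrix : ℕ → ℕ → Set
Matrix m n = Fin m → Fin n → ℚ

Vector : ℕ → Set
Vector n = Fin n → ℚ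

sumF : ∀ {n} → (Fin n → ℚ) → ℚ
sumF {zero}  f = 0ℚ
sumF {suc n} f = f zero + sumF (f ∘ suc)

adjMatrix : ∀ {n} → (Fin n → Fin n → Bool) → Matrix n n
adjMatrix a i j = if a i j then 1ℚ else 0ℚ

identity : ∀ {n} → Matrix n n
identity zero    zero    = 1ℚ
identity zero    (suc j) = 0ℚ
identity (suc i) zero    = 0ℚ
identity (suc i) (suc j) = identity i j

_⊕_ : ∀ {m n} → Matrix m n → Matrix m n → Matrix m n
(M ⊕ N) i j = M i j + N i j

mulVec : ∀ {m n} → Matrix m n → Vector n → Vector m
mulVec M v i = sumF (λ j → M i j * v j)

lincomb : ∀ {r n} → (Fin r → Vector n) → (Fin r → ℚ) → Vector n
lincomb vs c j = sumF (λ i → c i * vs i j)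

LinIndep : ∀ {r n} → (Fin r → Vector n) → Set
LinIndep vs = ∀ c → (∀ j → lincomb vs c j ≡ 0ℚ) → ∀ i → c i ≡ 0ℚ

HasRank : ∀ {m n} → Matrix m n → ℕ → Set
HasRank {m} M r =
  (Σ (Fin r → Fin m) λ f → LinIndep (M ∘ f)) ×
  (∀ (f : Fin (suc r) → Fin m) → ¬ LinIndep (M ∘ f))

IsEigenvector : ∀ {n} → Matrix n n → ℚ → Vector n → Set
IsEigenvector M λ' v = ∀ i → mulVec M v i ≡ λ' * v i

-- λ is an eigenvalue of M of multiplicity k (k = 0: not an eigenvalue);
-- multiplicity = dimension of the eigenspace.
EigMult : ∀ {n} → Matrix n n → ℚ → ℕ → Set
EigMult M λ' k =
  (Σ (Fin k → Vector _) λ vs → (∀ i → IsEigenvector M λ' (vs i)) × LinIndep vs) ×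
  (∀ (vs : Fin (suc k) → Vector _) → (∀ i → IsEigenvector M λ' (vs i)) → ¬ LinIndep vs)

IsCSPartition : ∀ {n m} → Graph n → (Fin n → Fin m) → Set
IsCSPartition {n} {m} Γ p =
  (∀ (a : Fin m) → ∃ λ u → p u ≡ a) ×
  (∀ u v → p u ≡ p v → u ≢ v → adj Γ u v ≡ true) ×
  (∀ u v u' v' → p u ≢ p v → p u ≡ p u' → p v ≡ p v' →
     adj Γ u v ≡ adj Γ u' v')

IsCompleteSkeleton : ∀ {n m} → Graph n → (Fin n → Fin m) → Set
IsCompleteSkeleton {n} {m} Γ p =
  IsCSPartition Γ p × (∀ m' (q : Fin n → Fin m') → IsCSPartition Γ q → m ≤ m')

-- s is the adjacency of the structure graph SΩ of the partition p:
-- distinct parts adjacent iff completely joined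
IsStructure : ∀ {n m} → Graph n → (Fin n → Fin m) → (Fin m → Fin m → Bool) → Set
IsStructure {n} {m} Γ p s =
  ∀ a b → (s a b ≡ true) ⇔ (a ≢ b × (∀ u v → p u ≡ a → p v ≡ b → adj Γ u v ≡ true))

{-# OPTIONS --safe #-}
-- Since the parts of the skeleton are cliques joined all-or-nothing, the matrix I + A(Γ) arises
-- from I + A(SΩ(Γ)) by repeating rows and columns, so the two have the same rank r.  The
-- (-1)-eigenspace of A(Γ) is the kernel of I + A(Γ), which has dimension n - r by rank–nullity.
-- Over ℚ rank–nullity follows from Gaussian elimination together with the positive definiteness
-- of the standard inner product: kernel vectors are orthogonal to the rows, so a maximal
-- independent set of rows and an independent set of kernel vectors are jointly independent.
module Submission where

open import Defs
open import Data.Nat using (ℕ; _∸_; zero; suc)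
import Data.Nat as ℕ
import Data.Nat.Properties as ℕₚ
open import Data.Fin using (Fin; zero; suc; punchIn; _↑ˡ_; _↑ʳ_; splitAt; join)
open import Data.Fin.Properties using (_≟_; all?; ¬∀⟶∃¬; punchInᵢ≢i; join-splitAt)
open import Data.Bool using (Bool; true; false; if_then_else_)
open import Data.Bool.Properties using (¬-not; not-¬)
open import Data.Rational
  using (ℚ; 0ℚ; 1ℚ; _+_; _*_; -_; 1/_; _÷_; _≤_; NonZero; ≢-nonZero; nonNegative; nonPositive)
import Data.Rational.Properties as ℚ
open import Data.Rational.Solver using (module +-*-Solver)
open import Data.Vec.Functional using (_∷_; _++_; insertAt)
open import Data.Vec.Functional.Properties
  using (lookup-++ˡ; lookup-++ʳ; insertAt-lookup; insertAt-punchIn)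
open import Algebra.Bundles using (Ring)
open import Algebra.Properties.Semiring.Sum (Ring.semiring ℚ.+-*-ring)
  using (sum; sum-cong-≗; sum-replicate-zero; ∑-distrib-+; sum-remove; *-distribˡ-sum; *-distribʳ-sum)
open import Algebra.Properties.Group ℚ.+-0-group using (inverseʳ-unique)
open import Algebra.Properties.Ring ℚ.+-*-ring using (-1*x≈-x)
open import Data.Empty using (⊥-elim)
open import Data.Sum using (_⊎_; inj₁; inj₂)
open import Data.Product using (Σ; ∃; _×_; _,_; proj₁; proj₂)
open import Function using (_∘_; _⇔_)
open import Function.Bundles using (mk⇔; Equivalence)
open import Relation.Binary.PropositionalEquality
  using (_≡_; _≢_; refl; sym; trans; cong; cong₂; subst; subst₂; module ≡-Reasoning)
open import Relation.Nullary using (¬_; yes; no; contradiction)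
open import Relation.Nullary.Decidable using (decidable-stable)

open Equivalence using (to; from)
open +-*-Solver using (solve; _:+_; _:*_; _:=_)

sumF≡sum : ∀ {n} (f : Fin n → ℚ) → sumF f ≡ sum f
sumF≡sum {zero}  f = refl
sumF≡sum {suc n} f = cong (f zero +_) (sumF≡sum (f ∘ suc))

sumF-cong : ∀ {n} {f g : Fin n → ℚ} → (∀ i → f i ≡ g i) → sumF f ≡ sumF g
sumF-cong {f = f} {g} f≗g = trans (sumF≡sum f) (trans (sum-cong-≗ f≗g) (sym (sumF≡sum g)))

sumF-0 : ∀ {n} {f : Fin n → ℚ} → (∀ i → f i ≡ 0ℚ) → sumF f ≡ 0ℚ
sumF-0 {n} f≗0 = trans (sumF-cong f≗0) (trans (sumF≡sum {n} (λ _ → 0ℚ)) (sum-replicate-zero n))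

sumF-+ : ∀ {n} (f g : Fin n → ℚ) → sumF (λ i → f i + g i) ≡ sumF f + sumF g
sumF-+ f g = trans (sumF≡sum (λ i → f i + g i))
  (trans (∑-distrib-+ f g) (sym (cong₂ _+_ (sumF≡sum f) (sumF≡sum g))))

sumF-*ˡ : ∀ {n} a (f : Fin n → ℚ) → a * sumF f ≡ sumF (λ i → a * f i)
sumF-*ˡ a f = trans (cong (a *_) (sumF≡sum f))
  (trans (*-distribˡ-sum a f) (sym (sumF≡sum (λ i → a * f i))))

sumF-*ʳ : ∀ {n} a (f : Fin n → ℚ) → sumF f * a ≡ sumF (λ i → f i * a)
sumF-*ʳ a f = trans (cong (_* a) (sumF≡sum f))
  (trans (*-distribʳ-sum a f) (sym (sumF≡sum (λ i → f i * a))))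

sumF-remove : ∀ {n} (f : Fin (suc n) → ℚ) j → sumF f ≡ f j + sumF (f ∘ punchIn j)
sumF-remove f j = trans (sumF≡sum f)
  (trans (sum-remove f) (cong (f j +_) (sym (sumF≡sum (f ∘ punchIn j)))))

sumF-single : ∀ {n} (f : Fin n → ℚ) j → (∀ i → i ≢ j → f i ≡ 0ℚ) → sumF f ≡ f j
sumF-single {suc n} f j f≡0 = begin
  sumF f                         ≡⟨ sumF-remove f j ⟩
  f j + sumF (f ∘ punchIn j)     ≡⟨ cong (f j +_) (sumF-0 (λ i → f≡0 (punchIn j i) (punchInᵢ≢i j i))) ⟩
  f j + 0ℚ                       ≡⟨ ℚ.+-identityʳ (f j) ⟩
  f j                            ∎
  where open ≡-Reasoning

sumF-splitAt : ∀ {r s} (f : Fin (r ℕ.+ s) → ℚ) →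
               sumF f ≡ sumF (λ i → f (i ↑ˡ s)) + sumF (λ j → f (r ↑ʳ j))
sumF-splitAt {zero}  f = sym (ℚ.+-identityˡ _)
sumF-splitAt {suc r} {s} f = trans (cong (f zero +_) (sumF-splitAt {r} {s} (f ∘ suc)))
  (sym (ℚ.+-assoc (f zero) (sumF (λ i → f (suc i ↑ˡ s))) (sumF (λ j → f (suc r ↑ʳ j)))))

p+q≡0⇒p≡0 : ∀ {p q} → 0ℚ ≤ p → 0ℚ ≤ q → p + q ≡ 0ℚ → p ≡ 0ℚ
p+q≡0⇒p≡0 {p} {q} 0≤p 0≤q p+q≡0 = ℚ.≤-antisym p≤0 0≤p
  where
  p≤0 : p ≤ 0ℚ
  p≤0 = subst₂ _≤_ (ℚ.+-identityʳ p) p+q≡0 (ℚ.+-monoʳ-≤ p 0≤q)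

sumF-nonneg : ∀ {n} (f : Fin n → ℚ) → (∀ i → 0ℚ ≤ f i) → 0ℚ ≤ sumF f
sumF-nonneg {zero}  f 0≤f = ℚ.≤-refl
sumF-nonneg {suc n} f 0≤f = ℚ.+-mono-≤ (0≤f zero) (sumF-nonneg (f ∘ suc) (0≤f ∘ suc))

sumF-nonneg-zero : ∀ {n} (f : Fin n → ℚ) → (∀ i → 0ℚ ≤ f i) → sumF f ≡ 0ℚ → ∀ i → f i ≡ 0ℚ
sumF-nonneg-zero {suc n} f 0≤f Σf≡0 zero =
  p+q≡0⇒p≡0 (0≤f zero) (sumF-nonneg (f ∘ suc) (0≤f ∘ suc)) Σf≡0
sumF-nonneg-zero {suc n} f 0≤f Σf≡0 (suc i) = sumF-nonneg-zero (f ∘ suc) (0≤f ∘ suc)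
  (p+q≡0⇒p≡0 (sumF-nonneg (f ∘ suc) (0≤f ∘ suc)) (0≤f zero)
    (trans (ℚ.+-comm _ (f zero)) Σf≡0)) i

p*q≡0⇒p≡0 : ∀ p q .{{_ : NonZero q}} → p * q ≡ 0ℚ → p ≡ 0ℚ
p*q≡0⇒p≡0 p q pq≡0 = begin
  p                ≡⟨ ℚ.*-identityʳ p ⟨
  p * 1ℚ           ≡⟨ cong (p *_) (ℚ.*-inverseʳ q) ⟨
  p * (q * 1/ q)   ≡⟨ ℚ.*-assoc p q (1/ q) ⟨
  p * q * 1/ q     ≡⟨ cong (_* 1/ q) pq≡0 ⟩
  0ℚ * 1/ q        ≡⟨ ℚ.*-zeroˡ (1/ q) ⟩
  0ℚ               ∎
  where open ≡-Reasoning

p*p≥0 : ∀ p → 0ℚ ≤ p * p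
p*p≥0 p with ℚ.≤-total 0ℚ p
... | inj₁ 0≤p = ℚ.nonNegative⁻¹ (p * p)
      {{ℚ.nonNeg*nonNeg⇒nonNeg p {{nonNegative 0≤p}} p {{nonNegative 0≤p}}}}
... | inj₂ p≤0 = ℚ.nonNegative⁻¹ (p * p)
      {{ℚ.nonPos*nonPos⇒nonPos p {{nonPositive p≤0}} p {{nonPositive p≤0}}}}

p*p≡0⇒p≡0 : ∀ p → p * p ≡ 0ℚ → p ≡ 0ℚ
p*p≡0⇒p≡0 p pp≡0 = decidable-stable (p ℚ.≟ 0ℚ)
  (λ p≢0 → p≢0 (p*q≡0⇒p≡0 p p {{≢-nonZero p≢0}} pp≡0))

zeros-or-nonzero : ∀ {k} (φ : Fin k → ℚ) → (∀ i → φ i ≡ 0ℚ) ⊎ ∃ λ i → φ i ≢ 0ℚ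
zeros-or-nonzero φ with all? (λ i → φ i ℚ.≟ 0ℚ)
... | yes φ≡0 = inj₁ φ≡0
... | no  φ≢0 = inj₂ (¬∀⟶∃¬ _ _ (λ i → φ i ℚ.≟ 0ℚ) φ≢0)

-- The standard inner product

dot : ∀ {n} → Vector n → Vector n → ℚ
dot u v = sumF (λ x → u x * v x)

dot-comm : ∀ {n} (u v : Vector n) → dot u v ≡ dot v u
dot-comm u v = sumF-cong (λ x → ℚ.*-comm (u x) (v x))

dot-zeroʳ : ∀ {n} (u : Vector n) {v : Vector n} → (∀ x → v x ≡ 0ℚ) → dot u v ≡ 0ℚ
dot-zeroʳ u v≡0 = sumF-0 (λ x → trans (cong (u x *_) (v≡0 x)) (ℚ.*-zeroʳ (u x)))

dot-+ʳ : ∀ {n} (w u v : Vector n) → dot w (λ x → u x + v x) ≡ dot w u + dot w v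
dot-+ʳ w u v = trans (sumF-cong (λ x → ℚ.*-distribˡ-+ (w x) (u x) (v x)))
  (sumF-+ (λ x → w x * u x) (λ x → w x * v x))

dot-*ʳ : ∀ {n} (w : Vector n) a (v : Vector n) → dot w (λ x → a * v x) ≡ a * dot w v
dot-*ʳ w a v = trans (sumF-cong (λ x → swap (w x) a (v x))) (sym (sumF-*ˡ a (λ x → w x * v x)))
  where
  swap : ∀ w a v → w * (a * v) ≡ a * (w * v)
  swap = solve 3 (λ w a v → w :* (a :* v) := a :* (w :* v)) refl

dot-self≡0 : ∀ {n} (u : Vector n) → dot u u ≡ 0ℚ → ∀ x → u x ≡ 0ℚ
dot-self≡0 u u·u≡0 x =
  p*p≡0⇒p≡0 (u x) (sumF-nonneg-zero _ (λ y → p*p≥0 (u y)) u·u≡0 x)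

orthogonal-sum-zero : ∀ {n} {u v : Vector n} → dot u v ≡ 0ℚ → (∀ x → u x + v x ≡ 0ℚ) →
                      ∀ x → u x ≡ 0ℚ
orthogonal-sum-zero {u = u} {v} u·v≡0 u+v≡0 = dot-self≡0 u (begin
  dot u u                     ≡⟨ ℚ.+-identityʳ (dot u u) ⟨
  dot u u + 0ℚ                ≡⟨ cong (dot u u +_) u·v≡0 ⟨
  dot u u + dot u v           ≡⟨ dot-+ʳ u u v ⟨
  dot u (λ x → u x + v x)     ≡⟨ dot-zeroʳ u u+v≡0 ⟩
  0ℚ                          ∎)
  where open ≡-Reasoning

lincomb-orthogonal : ∀ {r n} (y : Vector n) (vs : Fin r → Vector n) c →
                     (∀ i → dot y (vs i) ≡ 0ℚ) → dot y (lincomb vs c) ≡ 0ℚ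
lincomb-orthogonal {zero}  y vs c y⊥vs = dot-zeroʳ y (λ _ → refl)
lincomb-orthogonal {suc r} y vs c y⊥vs = begin
  dot y (λ x → c zero * vs zero x + rest x)     ≡⟨ dot-+ʳ y _ rest ⟩
  dot y (λ x → c zero * vs zero x) + dot y rest ≡⟨ cong₂ _+_ (dot-*ʳ y (c zero) (vs zero))
                                                    (lincomb-orthogonal y (vs ∘ suc) (c ∘ suc) (y⊥vs ∘ suc)) ⟩
  c zero * dot y (vs zero) + 0ℚ                 ≡⟨ cong (λ t → c zero * t + 0ℚ) (y⊥vs zero) ⟩
  c zero * 0ℚ + 0ℚ                              ≡⟨ cong (_+ 0ℚ) (ℚ.*-zeroʳ (c zero)) ⟩
  0ℚ                                            ∎
  where
  open ≡-Reasoning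
  rest = lincomb (vs ∘ suc) (c ∘ suc)

-- Linear independence

identity-diag : ∀ {n} (i : Fin n) → identity i i ≡ 1ℚ
identity-diag zero    = refl
identity-diag (suc i) = identity-diag i

identity-off : ∀ {n} {i j : Fin n} → i ≢ j → identity i j ≡ 0ℚ
identity-off {i = zero}  {zero}  i≢j = contradiction refl i≢j
identity-off {i = zero}  {suc j} i≢j = refl
identity-off {i = suc i} {zero}  i≢j = refl
identity-off {i = suc i} {suc j} i≢j = identity-off (i≢j ∘ cong suc)

identity-indep : ∀ {n} → LinIndep (identity {n})
identity-indep c comb≡0 j = begin
  c j                             ≡⟨ ℚ.*-identityʳ (c j) ⟨
  c j * 1ℚ                        ≡⟨ cong (c j *_) (identity-diag j) ⟨
  c j * identity j j              ≡⟨ sumF-single (λ i → c i * identity i j) j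
                                       (λ i i≢j → trans (cong (c i *_) (identity-off i≢j)) (ℚ.*-zeroʳ (c i))) ⟨
  lincomb identity c j            ≡⟨ comb≡0 j ⟩
  0ℚ                              ∎
  where open ≡-Reasoning

LinIndep-tail : ∀ {r n} {vs : Fin (suc r) → Vector n} → LinIndep vs → LinIndep (vs ∘ suc)
LinIndep-tail {vs = vs} vs-indep c comb≡0 i = vs-indep (0ℚ ∷ c) comb′≡0 (suc i)
  where
  comb′≡0 : ∀ x → lincomb vs (0ℚ ∷ c) x ≡ 0ℚ
  comb′≡0 x = trans (cong (_+ lincomb (vs ∘ suc) c x) (ℚ.*-zeroˡ (vs zero x)))
                    (trans (ℚ.+-identityˡ _) (comb≡0 x))

LinIndep-dropZeroColumn : ∀ {k n} (us : Fin k → Vector (suc n)) → LinIndep us →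
                          (∀ i → us i zero ≡ 0ℚ) → LinIndep (λ i → us i ∘ suc)
LinIndep-dropZeroColumn us us-indep column≡0 c comb≡0 = us-indep c comb′≡0
  where
  comb′≡0 : ∀ x → lincomb us c x ≡ 0ℚ
  comb′≡0 zero    = sumF-0 (λ i → trans (cong (c i *_) (column≡0 i)) (ℚ.*-zeroʳ (c i)))
  comb′≡0 (suc x) = comb≡0 x

shear : ∀ {t n} → (Fin (suc t) → Vector n) → Fin (suc t) → (Fin t → ℚ) → Fin t → Vector n
shear zs j α i x = α i * zs j x + zs (punchIn j i) x

LinIndep-shear : ∀ {t n} (zs : Fin (suc t) → Vector n) j α → LinIndep zs → LinIndep (shear zs j α)
LinIndep-shear zs j α zs-indep c comb≡0 i =
  trans (sym (insertAt-punchIn c j S i)) (zs-indep d d-comb≡0 (punchIn j i))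
  where
  S : ℚ
  S = sumF (λ i → c i * α i)
  d : Fin _ → ℚ
  d = insertAt c j S
  distrib : ∀ c a z u → c * a * z + c * u ≡ c * (a * z + u)
  distrib = solve 4 (λ c a z u → c :* a :* z :+ c :* u := c :* (a :* z :+ u)) refl
  d-comb≡0 : ∀ x → lincomb zs d x ≡ 0ℚ
  d-comb≡0 x = begin
    sumF (λ k → d k * zs k x)
      ≡⟨ sumF-remove (λ k → d k * zs k x) j ⟩
    d j * zs j x + sumF (λ i → d (punchIn j i) * zs (punchIn j i) x)
      ≡⟨ cong₂ _+_ (cong (_* zs j x) (insertAt-lookup c j S))
                   (sumF-cong (λ i → cong (_* zs (punchIn j i) x) (insertAt-punchIn c j S i))) ⟩
    S * zs j x + sumF (λ i → c i * zs (punchIn j i) x)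
      ≡⟨ cong (_+ _) (sumF-*ʳ (zs j x) (λ i → c i * α i)) ⟩
    sumF (λ i → c i * α i * zs j x) + sumF (λ i → c i * zs (punchIn j i) x)
      ≡⟨ sumF-+ (λ i → c i * α i * zs j x) (λ i → c i * zs (punchIn j i) x) ⟨
    sumF (λ i → c i * α i * zs j x + c i * zs (punchIn j i) x)
      ≡⟨ sumF-cong (λ i → distrib (c i) (α i) (zs j x) (zs (punchIn j i) x)) ⟩
    lincomb (shear zs j α) c x
      ≡⟨ comb≡0 x ⟩
    0ℚ ∎
    where open ≡-Reasoning

pivot : ∀ {t} (φ : Fin (suc t) → ℚ) j → φ j ≢ 0ℚ → Fin t → ℚ
pivot φ j φj≢0 i = - (φ (punchIn j i) ÷ φ j)
  where instance _ = ≢-nonZero φj≢0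

pivot-cancel : ∀ {t} (φ : Fin (suc t) → ℚ) j (φj≢0 : φ j ≢ 0ℚ) i →
               pivot φ j φj≢0 i * φ j + φ (punchIn j i) ≡ 0ℚ
pivot-cancel φ j φj≢0 i = begin
  - (a * 1/ b) * b + a    ≡⟨ cong (_+ a) (ℚ.neg-distribˡ-* (a * 1/ b) b) ⟨
  - (a * 1/ b * b) + a    ≡⟨ cong (λ t → - t + a) (ℚ.*-assoc a (1/ b) b) ⟩
  - (a * (1/ b * b)) + a  ≡⟨ cong (λ t → - (a * t) + a) (ℚ.*-inverseˡ b) ⟩
  - (a * 1ℚ) + a          ≡⟨ cong (λ t → - t + a) (ℚ.*-identityʳ a) ⟩
  - a + a                 ≡⟨ ℚ.+-inverseˡ a ⟩
  0ℚ                      ∎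
  where
  open ≡-Reasoning
  a = φ (punchIn j i)
  b = φ j
  instance _ = ≢-nonZero φj≢0

LinIndep⇒≤ : ∀ {k n} (us : Fin k → Vector n) → LinIndep us → k ℕ.≤ n
LinIndep⇒≤ {zero}          us us-indep = ℕ.z≤n
LinIndep⇒≤ {suc k} {zero}  us us-indep = contradiction (us-indep (λ _ → 1ℚ) (λ ()) zero) λ ()
LinIndep⇒≤ {suc k} {suc n} us us-indep with zeros-or-nonzero (λ i → us i zero)
... | inj₁ column≡0 =
  ℕₚ.m≤n⇒m≤1+n (LinIndep⇒≤ (λ i → us i ∘ suc) (LinIndep-dropZeroColumn us us-indep column≡0))
... | inj₂ (j , usj≢0) = ℕ.s≤s (LinIndep⇒≤ (λ i → sheared i ∘ suc)
  (LinIndep-dropZeroColumn sheared (LinIndep-shear us j α us-indep) (pivot-cancel φ j usj≢0)))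
  where
  φ = λ i → us i zero
  α = pivot φ j usj≢0
  sheared = shear us j α

LinIndep-∷ : ∀ {r n} {w z : Vector n} {vs : Fin r → Vector n} → LinIndep vs →
             (∀ i → dot z (vs i) ≡ 0ℚ) → dot z w ≢ 0ℚ → LinIndep (w ∷ vs)
LinIndep-∷ {w = w} {z} {vs} vs-indep z⊥vs z·w≢0 c comb≡0 = coeff≡0
  where
  rest = lincomb vs (c ∘ suc)
  c₀≡0 : c zero ≡ 0ℚ
  c₀≡0 = p*q≡0⇒p≡0 (c zero) (dot z w) {{≢-nonZero z·w≢0}} (begin
    c zero * dot z w                                ≡⟨ ℚ.+-identityʳ _ ⟨
    c zero * dot z w + 0ℚ                           ≡⟨ cong₂ _+_ (dot-*ʳ z (c zero) w)
                                                         (lincomb-orthogonal z vs (c ∘ suc) z⊥vs) ⟨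
    dot z (λ x → c zero * w x) + dot z rest         ≡⟨ dot-+ʳ z _ rest ⟨
    dot z (lincomb (w ∷ vs) c)                      ≡⟨ dot-zeroʳ z comb≡0 ⟩
    0ℚ                                              ∎)
    where open ≡-Reasoning
  rest≡0 : ∀ x → rest x ≡ 0ℚ
  rest≡0 x = begin
    rest x                       ≡⟨ ℚ.+-identityˡ (rest x) ⟨
    0ℚ + rest x                  ≡⟨ cong (_+ rest x) (trans (cong (_* w x) c₀≡0) (ℚ.*-zeroˡ (w x))) ⟨
    c zero * w x + rest x        ≡⟨ comb≡0 x ⟩
    0ℚ                           ∎
    where open ≡-Reasoning
  coeff≡0 : ∀ i → c i ≡ 0ℚ
  coeff≡0 zero    = c₀≡0
  coeff≡0 (suc i) = vs-indep (c ∘ suc) rest≡0 i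

lincomb-++ : ∀ {r s n} (ws : Fin r → Vector n) (zs : Fin s → Vector n) c x →
             lincomb (ws ++ zs) c x ≡ lincomb ws (c ∘ (_↑ˡ s)) x + lincomb zs (c ∘ (r ↑ʳ_)) x
lincomb-++ {r} {s} ws zs c x = trans (sumF-splitAt {r} _) (cong₂ _+_
  (sumF-cong (λ i → cong (λ v → c (i ↑ˡ s) * v x) (lookup-++ˡ ws zs i)))
  (sumF-cong (λ j → cong (λ v → c (r ↑ʳ j) * v x) (lookup-++ʳ ws zs j))))

LinIndep-++ : ∀ {r s n} {ws : Fin r → Vector n} {zs : Fin s → Vector n} →
              LinIndep ws → LinIndep zs → (∀ i j → dot (ws i) (zs j) ≡ 0ℚ) → LinIndep (ws ++ zs)
LinIndep-++ {r} {s} {ws = ws} {zs} ws-indep zs-indep ws⊥zs c comb≡0 k =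
  subst (λ k → c k ≡ 0ℚ) (join-splitAt r s k) (coeff≡0 (splitAt r k))
  where
  a = c ∘ (_↑ˡ s)
  b = c ∘ (r ↑ʳ_)
  X = lincomb ws a
  Y = lincomb zs b
  X+Y≡0 : ∀ x → X x + Y x ≡ 0ℚ
  X+Y≡0 x = trans (sym (lincomb-++ ws zs c x)) (comb≡0 x)
  X·Y≡0 : dot X Y ≡ 0ℚ
  X·Y≡0 = lincomb-orthogonal X zs b (λ j → trans (dot-comm X (zs j))
            (lincomb-orthogonal (zs j) ws a (λ i → trans (dot-comm (zs j) (ws i)) (ws⊥zs i j))))
  coeff≡0 : ∀ e → c (join r s e) ≡ 0ℚ
  coeff≡0 (inj₁ i) = ws-indep a (orthogonal-sum-zero X·Y≡0 X+Y≡0) i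
  coeff≡0 (inj₂ j) = zs-indep b (orthogonal-sum-zero (trans (dot-comm Y X) X·Y≡0)
                                   (λ x → trans (ℚ.+-comm (Y x) (X x)) (X+Y≡0 x))) j

-- Dimension and rank–nullity

IndepFamily : ∀ {n} → (Vector n → Set) → ℕ → Set
IndepFamily {n} P k = Σ (Fin k → Vector n) λ vs → (∀ i → P (vs i)) × LinIndep vs

-- EigMult M λ k unfolds to HasDim (IsEigenvector M λ) k.
HasDim : ∀ {n} → (Vector n → Set) → ℕ → Set
HasDim {n} P k =
  IndepFamily P k × (∀ (vs : Fin (suc k) → Vector n) → (∀ i → P (vs i)) → ¬ LinIndep vs)

IndepFamily-≤ : ∀ {n k t} {P : Vector n → Set} → k ℕ.≤ t → IndepFamily P t → IndepFamily P k
IndepFamily-≤ {P = P} k≤t family with ℕₚ.m≤n⇒m<n∨m≡n k≤t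
... | inj₂ refl = family
... | inj₁ (ℕ.s≤s k≤t′) with family
...   | vs , vs∈P , vs-indep =
  IndepFamily-≤ {P = P} k≤t′ (vs ∘ suc , vs∈P ∘ suc , LinIndep-tail {vs = vs} vs-indep)

IndepFamily-≤dim : ∀ {n k d} {P : Vector n → Set} → HasDim P k → IndepFamily P d → d ℕ.≤ k
IndepFamily-≤dim {k = k} {d} {P} (_ , maximal) family with d ℕ.≤? k
... | yes d≤k = d≤k
... | no  d≰k with IndepFamily-≤ {P = P} (ℕₚ.≰⇒> d≰k) family
...   | vs , vs∈P , vs-indep = ⊥-elim (maximal vs vs∈P vs-indep)

HasDim-unique : ∀ {n k d} {P : Vector n → Set} → HasDim P k → HasDim P d → k ≡ d
HasDim-unique {P = P} dim-k dim-d =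
  ℕₚ.≤-antisym (IndepFamily-≤dim {P = P} dim-d (proj₁ dim-k))
               (IndepFamily-≤dim {P = P} dim-k (proj₁ dim-d))

HasDim-⇔ : ∀ {n k} {P Q : Vector n → Set} → (∀ v → P v ⇔ Q v) → HasDim P k → HasDim Q k
HasDim-⇔ P⇔Q ((vs , vs∈P , vs-indep) , maximal) =
  (vs , (λ i → to (P⇔Q (vs i)) (vs∈P i)) , vs-indep) ,
  (λ us us∈Q → maximal us (λ i → from (P⇔Q (us i)) (us∈Q i)))

Kernel : ∀ {m n} → Matrix m n → Vector n → Set
Kernel M v = ∀ i → mulVec M v i ≡ 0ℚ

kernel-step : ∀ {r n t} (M : Matrix (suc r) n) →
              IndepFamily (Kernel (M ∘ suc)) (suc t) → IndepFamily (Kernel M) t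
kernel-step M (zs , zs∈ker , zs-indep) with zeros-or-nonzero (λ j → dot (M zero) (zs j))
... | inj₁ M₀⊥zs = IndepFamily-≤ {P = Kernel M} (ℕₚ.n≤1+n _) (zs , zs∈kerM , zs-indep)
  where
  zs∈kerM : ∀ j → Kernel M (zs j)
  zs∈kerM j zero    = M₀⊥zs j
  zs∈kerM j (suc i) = zs∈ker j i
... | inj₂ (j , M₀·zj≢0) = shear zs j α , sheared∈ker , LinIndep-shear zs j α zs-indep
  where
  φ = λ j → dot (M zero) (zs j)
  α = pivot φ j M₀·zj≢0
  dot-shear : ∀ l i → dot (M l) (shear zs j α i) ≡ α i * dot (M l) (zs j) + dot (M l) (zs (punchIn j i))
  dot-shear l i = trans (dot-+ʳ (M l) _ (zs (punchIn j i)))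
                        (cong (_+ _) (dot-*ʳ (M l) (α i) (zs j)))
  sheared∈ker : ∀ i → Kernel M (shear zs j α i)
  sheared∈ker i zero    = trans (dot-shear zero i) (pivot-cancel φ j M₀·zj≢0 i)
  sheared∈ker i (suc l) = begin
    dot (M (suc l)) (shear zs j α i)   ≡⟨ dot-shear (suc l) i ⟩
    α i * dot (M (suc l)) (zs j) + dot (M (suc l)) (zs (punchIn j i))
                                       ≡⟨ cong₂ (λ a b → α i * a + b) (zs∈ker j l) (zs∈ker (punchIn j i) l) ⟩
    α i * 0ℚ + 0ℚ                      ≡⟨ cong (_+ 0ℚ) (ℚ.*-zeroʳ (α i)) ⟩
    0ℚ                                 ∎
    where open ≡-Reasoning

Kernel-indepFamily : ∀ {r n} (M : Matrix r n) → IndepFamily (Kernel M) (n ∸ r)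
Kernel-indepFamily {zero}      M = identity , (λ _ ()) , identity-indep
Kernel-indepFamily {suc r} {n} M =
  subst (IndepFamily (Kernel M)) (ℕₚ.pred[m∸n]≡m∸[1+n] n r) (eliminate (Kernel-indepFamily (M ∘ suc)))
  where
  eliminate : ∀ {t} → IndepFamily (Kernel (M ∘ suc)) t → IndepFamily (Kernel M) (ℕ.pred t)
  eliminate {zero}  _      = (λ ()) , (λ ()) , (λ _ _ ())
  eliminate {suc t} family = kernel-step M family

Kernel-maximalRows : ∀ {m n r} {M : Matrix m n} (f : Fin r → Fin m) → LinIndep (M ∘ f) →
                     (∀ (g : Fin (suc r) → Fin m) → ¬ LinIndep (M ∘ g)) →
                     ∀ {z} → Kernel (M ∘ f) z → Kernel M z
Kernel-maximalRows {M = M} f rows-indep maximal {z} z∈ker i =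
  decidable-stable (dot (M i) z ℚ.≟ 0ℚ) λ Mi·z≢0 →
    maximal (i ∷ f) (LinIndep-∷ {w = M i} {z} rows-indep (λ l → trans (dot-comm z (M (f l))) (z∈ker l))
                       (λ z·Mi≡0 → Mi·z≢0 (trans (dot-comm (M i) z) z·Mi≡0)))

rank-nullity : ∀ {m n r} {M : Matrix m n} → HasRank M r → HasDim (Kernel M) (n ∸ r)
rank-nullity {n = n} {r} {M} ((f , rows-indep) , maximal) with Kernel-indepFamily (M ∘ f)
... | zs , zs∈ker , zs-indep =
  (zs , (λ j → Kernel-maximalRows {M = M} f rows-indep maximal (zs∈ker j)) , zs-indep) , at-most
  where
  at-most : ∀ (vs : Fin (suc (n ∸ r)) → Vector n) → (∀ i → Kernel M (vs i)) → ¬ LinIndep vs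
  at-most vs vs∈ker vs-indep = ℕₚ.<⇒≱ n<r+size (LinIndep⇒≤ (M ∘ f ++ vs)
    (LinIndep-++ rows-indep vs-indep (λ i j → vs∈ker j (f i))))
    where
    open ℕₚ.≤-Reasoning
    n<r+size : n ℕ.< r ℕ.+ suc (n ∸ r)
    n<r+size = begin-strict
      n                  ≤⟨ ℕₚ.m≤n+m∸n n r ⟩
      r ℕ.+ (n ∸ r)      <⟨ ℕₚ.+-monoʳ-< r (ℕₚ.n<1+n (n ∸ r)) ⟩
      r ℕ.+ suc (n ∸ r)  ∎

HasRank-inflate : ∀ {m n m′ n′ r} {M : Matrix m n} {N : Matrix m′ n′}
                    {p : Fin m → Fin m′} {q : Fin n → Fin n′} →
                  (∀ a → ∃ λ u → p u ≡ a) → (∀ b → ∃ λ v → q v ≡ b) →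
                  (∀ u v → M u v ≡ N (p u) (q v)) → HasRank N r → HasRank M r
HasRank-inflate {m = m} {m′ = m′} {M = M} {N} {p} {q} p-onto q-onto M≡N ((f , rows-indep) , maximal) =
  (row ∘ f , inflated-indep) , inflated-maximal
  where
  row : Fin m′ → Fin m
  row a = proj₁ (p-onto a)
  comb-inflate : ∀ {k} (g : Fin k → Fin m) c v → lincomb (M ∘ g) c v ≡ lincomb (N ∘ p ∘ g) c (q v)
  comb-inflate g c v = sumF-cong (λ i → cong (c i *_) (M≡N (g i) v))
  inflated-indep : LinIndep (M ∘ row ∘ f)
  inflated-indep c comb≡0 = rows-indep c N-comb≡0
    where
    N-comb≡0 : ∀ b → lincomb (N ∘ f) c b ≡ 0ℚ
    N-comb≡0 b with q-onto b
    ... | v , refl =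
      trans (sumF-cong (λ i → cong (λ a → c i * N a (q v)) (sym (proj₂ (p-onto (f i))))))
            (trans (sym (comb-inflate (row ∘ f) c v)) (comb≡0 v))
  inflated-maximal : ∀ g → ¬ LinIndep (M ∘ g)
  inflated-maximal g M-indep = maximal (p ∘ g) λ c comb≡0 →
    M-indep c (λ v → trans (comb-inflate g c v) (comb≡0 (q v)))

mulVec-⊕ : ∀ {m n} (M N : Matrix m n) v i → mulVec (M ⊕ N) v i ≡ mulVec M v i + mulVec N v i
mulVec-⊕ M N v i = trans (sumF-cong (λ j → ℚ.*-distribʳ-+ (v j) (M i j) (N i j)))
                         (sumF-+ (λ j → M i j * v j) (λ j → N i j * v j))

mulVec-identity : ∀ {n} (v : Vector n) i → mulVec identity v i ≡ v i
mulVec-identity v i = begin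
  mulVec identity v i   ≡⟨ sumF-single (λ j → identity i j * v j) i
                             (λ j j≢i → trans (cong (_* v j) (identity-off (j≢i ∘ sym))) (ℚ.*-zeroˡ (v j))) ⟩
  identity i i * v i    ≡⟨ cong (_* v i) (identity-diag i) ⟩
  1ℚ * v i              ≡⟨ ℚ.*-identityˡ (v i) ⟩
  v i                   ∎
  where open ≡-Reasoning

Kernel-I+A⇔Eigen-1 : ∀ {n} (A : Matrix n n) v → Kernel (identity ⊕ A) v ⇔ IsEigenvector A (- 1ℚ) v
Kernel-I+A⇔Eigen-1 A v = mk⇔
  (λ v∈ker i → trans (inverseʳ-unique (v i) (mulVec A v i) (trans (sym (I+A-apply i)) (v∈ker i)))
                     (sym (-1*x≈-x (v i))))
  (λ eigen i → begin
    mulVec (identity ⊕ A) v i  ≡⟨ I+A-apply i ⟩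
    v i + mulVec A v i         ≡⟨ cong (v i +_) (trans (eigen i) (-1*x≈-x (v i))) ⟩
    v i + - v i                ≡⟨ ℚ.+-inverseʳ (v i) ⟩
    0ℚ                         ∎)
  where
  open ≡-Reasoning
  I+A-apply : ∀ i → mulVec (identity ⊕ A) v i ≡ v i + mulVec A v i
  I+A-apply i = trans (mulVec-⊕ identity A v i) (cong (_+ mulVec A v i) (mulVec-identity v i))

-- The skeleton

module _ {n m} (Γ : Graph n) (p : Fin n → Fin m) (s : Fin m → Fin m → Bool)
         (partition : IsCSPartition Γ p) (structure : IsStructure Γ p s) where

  private
    indicator : Bool → ℚ
    indicator b = if b then 1ℚ else 0ℚ
    cliques = proj₁ (proj₂ partition)
    all-or-nothing = proj₂ (proj₂ partition)

  structure-irreflexive : ∀ a → s a a ≡ false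
  structure-irreflexive a = ¬-not (λ saa≡true → proj₁ (to (structure a a) saa≡true) refl)

  adj≡structure : ∀ u v → p u ≢ p v → adj Γ u v ≡ s (p u) (p v)
  adj≡structure u v pu≢pv with s (p u) (p v) in s≡
  ... | true  = proj₂ (to (structure (p u) (p v)) s≡) u v refl refl
  ... | false = ¬-not λ uv≡true → not-¬ s≡ (from (structure (p u) (p v)) (pu≢pv , joined uv≡true))
    where
    joined : adj Γ u v ≡ true → ∀ u′ v′ → p u′ ≡ p u → p v′ ≡ p v → adj Γ u′ v′ ≡ true
    joined uv≡true u′ v′ pu′ pv′ =
      trans (sym (all-or-nothing u v u′ v′ pu≢pv (sym pu′) (sym pv′))) uv≡true

  I+A≡inflated : ∀ u v → (identity ⊕ adjMatrix (adj Γ)) u v ≡ (identity ⊕ adjMatrix s) (p u) (p v)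
  I+A≡inflated u v with u ≟ v | p u ≟ p v
  ... | yes refl | _ = cong₂ _+_ (trans (identity-diag u) (sym (identity-diag (p u))))
                                 (cong indicator (trans (adj-irr Γ u) (sym (structure-irreflexive (p u)))))
  ... | no u≢v | yes pu≡pv = begin
    identity u v + indicator (adj Γ u v)
      ≡⟨ cong₂ _+_ (identity-off u≢v) (cong indicator (cliques u v pu≡pv u≢v)) ⟩
    0ℚ + 1ℚ
      ≡⟨ ℚ.+-comm 0ℚ 1ℚ ⟩
    1ℚ + 0ℚ
      ≡⟨ cong₂ _+_ (identity-diag (p v)) (cong indicator (structure-irreflexive (p v))) ⟨
    identity (p v) (p v) + indicator (s (p v) (p v))
      ≡⟨ cong (λ a → identity a (p v) + indicator (s a (p v))) pu≡pv ⟨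
    identity (p u) (p v) + indicator (s (p u) (p v)) ∎
    where open ≡-Reasoning
  ... | no u≢v | no pu≢pv = cong₂ _+_ (trans (identity-off u≢v) (sym (identity-off pu≢pv)))
                                      (cong indicator (adj≡structure u v pu≢pv))

theorem4p7 : ∀ (n : ℕ) (Γ : Graph n) (m : ℕ) (p : Fin n → Fin m)
               (s : Fin m → Fin m → Bool) →
             IsCompleteSkeleton Γ p → IsStructure Γ p s →
             ∀ (k r : ℕ) → HasRank (identity ⊕ adjMatrix s) r →
             (EigMult (adjMatrix (adj Γ)) (- 1ℚ) k ⇔ (k ≡ n ∸ r))
theorem4p7 n Γ m p s (partition , _) structure k r rank =
  mk⇔ (λ multiplicity → HasDim-unique {P = IsEigenvector A (- 1ℚ)} multiplicity eigenspace)
      (λ { refl → eigenspace })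
  where
  A = adjMatrix (adj Γ)
  parts-nonempty = proj₁ partition
  I+A-rank : HasRank (identity ⊕ A) r
  I+A-rank = HasRank-inflate {M = identity ⊕ A} {N = identity ⊕ adjMatrix s}
    parts-nonempty parts-nonempty (I+A≡inflated Γ p s partition structure) rank
  eigenspace : HasDim (IsEigenvector A (- 1ℚ)) (n ∸ r)
  eigenspace = HasDim-⇔ (Kernel-I+A⇔Eigen-1 A) (rank-nullity {M = identity ⊕ A} I+A-rank)
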